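{- Let $\Sigma$ be a finite nonempty alphabet, let $m, n$ be integers with $0 < m < n < 2m$, and let $S \subseteq \Sigma^m \cup \Sigma^n$ be such that $S^*$ is co-finite. Then $S^* \ne \Sigma^*$, and every word in $\Sigma^* \setminus S^*$ has length at most $g(m,l) = ml - m - l$, where $l = m|\Sigma|^{n-m} + n - m$.
   Context: $\Sigma^j$ denotes the set of words of length exactly $j$ over $\Sigma$. A language $L \subseteq \Sigma^*$ is co-finite if $\Sigma^* \setminus L$ is finite. -}

module Defs where

open import Data.Nat using (ℕ; _*_; _+_; _∸_; _^_)
open import Data.Integer as ℤ using (ℤ; +_)
open import Data.List using (List; []; _++_)
open import Data.List.Membership.Propositional using (_∈_)
open import Data.Product using (∃)
open import Relation.Nullary using (¬_)
open import Level using (Level; _⊔_; suc)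

Language : ∀ {a} (A : Set a) (ℓ : Level) → Set (a ⊔ Level.suc ℓ)
Language A ℓ = List A → Set ℓ

data Star {a ℓ} {A : Set a} (S : Language A ℓ) : List A → Set (a ⊔ ℓ) where
  ε   : Star S []
  _·_ : ∀ {u w} → S u → Star S w → Star S (u ++ w)

CoFinite : ∀ {a ℓ} {A : Set a} → Language A ℓ → Set (a ⊔ ℓ)
CoFinite {A = A} L = ∃ λ (F : List (List A)) → ∀ w → ¬ L w → w ∈ F

-- l = m |Σ|^(n-m) + n - m   (n > m, so the truncated subtraction is exact)
ell : (k m n : ℕ) → ℕ
ell k m n = m * k ^ (n ∸ m) + (n ∸ m)

g : ℕ → ℕ → ℤ
g m l = (+ (m * l) ℤ.- + m) ℤ.- + l

module Submission where

-- Let d = n − m, so 0 < d < m. Every word u of length m lies in S: by cofiniteness the long words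
-- u v u v … u with |v| = d are in S*, and as a factor of length n can only consume u v, the last
-- factor is u.
-- Next, every word of length l = m k^d + d lies in S*. Cut it as y₀ e₁ y₁ … e_K y_K with |yᵢ| = d,
-- |eᵢ| = m − d and K = k^d. If it were not in S*, no window yᵢ₋₁ eᵢ yᵢ (of length n) could be in S,
-- as everything around the window is a product of words of length m. This is a path of length K in
-- the graph on words of length d with an edge y → y′ whenever y e y′ ∉ S; by pigeonhole the path
-- contains a cycle, and pumping it produces arbitrarily long words outside S*. Cofiniteness also
-- forces gcd(m, n) = 1, hence gcd(m, l) = 1, so by the Frobenius bound every length above
-- ml − m − l is a sum of m's and l's, i.e. the length of a word of S*. A single letter is not in S*
-- since m ≥ 2.

open import Defs
open import Data.Nat using (ℕ; _<_; _*_)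
open import Data.Integer as ℤ using (+_)
open import Data.Fin using (Fin)
open import Data.List using (List; length)
open import Data.Sum using (_⊎_)
open import Data.Product using (_×_)
open import Relation.Binary.PropositionalEquality using (_≡_)
open import Relation.Nullary using (¬_)
open import Level using (0ℓ)

open import Data.Nat
open import Data.Nat.Properties
open import Data.Nat.DivMod
open import Data.Nat.Coprimality using (Coprime; coprime-Bézout)
open import Data.Nat.Divisibility using (_∣_; _∣0; ∣m∣n⇒∣m+n; ∣m+n∣m⇒∣n; ∣1⇒≡1; ∣m⇒∣m*n)
open import Data.Nat.GCD using (module Bézout)
open import Data.Nat.Tactic.RingSolver using (solve-∀)
open import Data.Integer using (+≤+)
open import Data.Integer.Properties using (m-n≡m⊖n; ⊖-≥)
open import Data.Fin using (toℕ; cast; zero; suc; fromℕ<)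
open import Data.Fin.Base using (funToFin; finToFun)
open import Data.Fin.Properties using (finToFun-funToFin; toℕ-cast; toℕ-injective; pigeonhole; cast-involutive)
open import Data.List using ([]; _∷_; _++_; lookup; replicate; map)
open import Data.List.Properties
  using (++-assoc; length-++; length-replicate; ++-identityʳ; ∷-injective; length-++-≤ˡ; length-++-≤ʳ)
open import Data.List.Relation.Binary.Pointwise using (lookup⁻; Pointwise-≡⇒≡)
open import Data.List.Membership.Propositional.Properties using (∈-map⁺)
open import Data.List.Relation.Unary.All as All using ()
open import Data.List.Extrema.Nat using (max; xs≤max)
open import Data.Product using (∃; ∃₂; _,_; proj₁; proj₂)
open import Data.Sum using (inj₁; inj₂)
open import Data.Empty using (⊥; ⊥-elim)
open import Effect.Monad using (RawMonad)
open import Function using (_∘_)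
open import Level using (Level)
open import Relation.Nullary using (yes; no)
open import Relation.Nullary.Decidable using (decidable-stable)
open import Relation.Nullary.Negation using (¬¬-Monad)
open import Relation.Binary.PropositionalEquality

private variable
  a ℓ : Level
  A : Set a

++-injective : ∀ (xs ys : List A) {xs′ ys′} → length xs ≡ length ys → xs ++ xs′ ≡ ys ++ ys′ → xs ≡ ys × xs′ ≡ ys′
++-injective []       []       _         eq = refl , eq
++-injective (x ∷ xs) (y ∷ ys) |xs|≡|ys| eq =
  let x≡y , eq′ = ∷-injective eq
      xs≡ys , xs′≡ys′ = ++-injective xs ys (suc-injective |xs|≡|ys|) eq′
  in cong₂ _∷_ x≡y xs≡ys , xs′≡ys′

[x++y++z]++w≡x++y++z++w : ∀ (x y z : List A) {w} → (x ++ y ++ z) ++ w ≡ x ++ y ++ z ++ w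
[x++y++z]++w≡x++y++z++w x y z {w} = trans (++-assoc x (y ++ z) w) (cong (x ++_) (++-assoc y z w))

split-length : ∀ i {j} (w : List A) → length w ≡ i + j →
               ∃₂ λ u v → u ++ v ≡ w × length u ≡ i × length v ≡ j
split-length zero    w       |w| = [] , w , refl , refl , |w|
split-length (suc i) (c ∷ w) |w| =
  let u , v , u++v≡w , |u| , |v| = split-length i w (suc-injective |w|)
  in c ∷ u , v , cong (c ∷_) u++v≡w , cong suc |u| , |v|

module _ {a ℓ} {A : Set a} {S : Language A ℓ} where

  S⊆Star : ∀ {u} → S u → Star S u
  S⊆Star {u} su = subst (Star S) (++-identityʳ u) (su · ε)

  Star-++ : ∀ {u v} → Star S u → Star S v → Star S (u ++ v)
  Star-++                   ε           sv = sv
  Star-++ {v = v} (_·_ {u} {w} su sw) sv = subst (Star S) (sym (++-assoc u w v)) (su · Star-++ sw sv)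

  Star-length-∣ : ∀ {i w} → (∀ {u} → S u → i ∣ length u) → Star S w → i ∣ length w
  Star-length-∣ S∣ ε = _ ∣0
  Star-length-∣ S∣ (_·_ {u} su sw) = subst (_ ∣_) (sym (length-++ u)) (∣m∣n⇒∣m+n (S∣ su) (Star-length-∣ S∣ sw))

  open RawMonad (¬¬-Monad {a = a Level.⊔ ℓ})

  Star-multiple : ∀ {p} → (∀ {u} → length u ≡ p → ¬ ¬ Star S u) → ∀ j {w} → length w ≡ j * p → ¬ ¬ Star S w
  Star-multiple _      zero    {[]} _   = pure ε
  Star-multiple {p} Star-p (suc j) {w} |w|
    with u , v , refl , |u| , |v| ← split-length p w |w| = do
    su ← Star-p {u} |u|
    sv ← Star-multiple Star-p j {v} |v|
    pure (Star-++ su sv)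

module _ {a ℓ} {A : Set a} {L : Language A ℓ} (cof : CoFinite L) where

  long-words : ∃ λ N → ∀ w → N < length w → ¬ ¬ L w
  long-words = N , λ w N<|w| w∉L →
    <⇒≱ N<|w| (All.lookup (xs≤max 0 (map length F)) (∈-map⁺ length (F-complete w w∉L)))
    where
    F = proj₁ cof
    F-complete = proj₂ cof
    N = max 0 (map length F)

  cofinite-divisor≡1 : A → ∀ {i} → (∀ {w} → L w → i ∣ length w) → i ≡ 1
  cofinite-divisor≡1 x {i} L∣ = decidable-stable (i ≟ 1) λ i≢1 →
    long (suc N) ≤-refl λ i∣N+1 → long (suc (suc N)) (n≤1+n _) λ i∣N+2 →
    i≢1 (∣1⇒≡1 (∣m+n∣m⇒∣n (subst (i ∣_) (+-comm 1 (suc N)) (|xʲ| i∣N+2)) (|xʲ| i∣N+1)))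
    where
    N = proj₁ long-words
    long : ∀ j → N < j → ¬ ¬ L (replicate j x)
    long j N<j = proj₂ long-words (replicate j x) (subst (N <_) (sym (length-replicate j)) N<j)
    |xʲ| : ∀ {j} → L (replicate j x) → i ∣ j
    |xʲ| {j} = subst (i ∣_) (length-replicate j) ∘ L∣

funToFin-injective : ∀ {j k} {f g : Fin j → Fin k} → funToFin f ≡ funToFin g → ∀ i → f i ≡ g i
funToFin-injective {f = f} {g} eq i =
  trans (sym (finToFun-funToFin f i)) (trans (cong (λ c → finToFun c i) eq) (finToFun-funToFin g i))

code : ∀ {k j} (w : List (Fin k)) → length w ≡ j → Fin (k ^ j)
code w |w| = funToFin (lookup w ∘ cast (sym |w|))

code-injective : ∀ {k j} {w w′ : List (Fin k)} (|w| : length w ≡ j) (|w′| : length w′ ≡ j) →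
                 code w |w| ≡ code w′ |w′| → w ≡ w′
code-injective {w = w} {w′} |w| |w′| eq = Pointwise-≡⇒≡ (lookup⁻ (trans |w| (sym |w′|)) lookup-≡)
  where
  lookup-≡ : ∀ {i i′} → toℕ i ≡ toℕ i′ → lookup w i ≡ lookup w′ i′
  lookup-≡ {i} {i′} i≡i′ = begin
    lookup w i                                ≡⟨ cong (lookup w) (cast-involutive (sym |w|) |w| i) ⟨
    lookup w (cast (sym |w|) (cast |w| i))    ≡⟨ funToFin-injective eq (cast |w| i) ⟩
    lookup w′ (cast (sym |w′|) (cast |w| i))  ≡⟨ cong (lookup w′) (toℕ-injective
                                                   (trans (toℕ-cast (sym |w′|) (cast |w| i)) (trans (toℕ-cast |w| i) i≡i′))) ⟩
    lookup w′ i′                              ∎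
    where open ≡-Reasoning

words-pigeonhole : ∀ {k j} (ws : Fin (suc (k ^ j)) → List (Fin k)) → (∀ i → length (ws i) ≡ j) →
                   ∃₂ λ i i′ → toℕ i < toℕ i′ × ws i ≡ ws i′
words-pigeonhole ws |ws| =
  let i , i′ , i<i′ , eq = pigeonhole (n<1+n _) (λ i → code (ws i) (|ws| i))
  in i , i′ , i<i′ , code-injective (|ws| i) (|ws| i′) eq

alternate : List A → List A → ℕ → List A
alternate u v zero    = u
alternate u v (suc q) = u ++ v ++ alternate u v q

length-alternate : ∀ {u v : List A} q → 0 < length u → q < length (alternate u v q)
length-alternate zero 0<|u| = 0<|u|
length-alternate {u = u} {v} (suc q) 0<|u| = begin-strict
  suc q                                          <⟨ +-mono-≤ 0<|u| (length-alternate q 0<|u|) ⟩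
  length u + length (alternate u v q)            ≤⟨ +-monoʳ-≤ (length u) (m≤n+m _ (length v)) ⟩
  length u + (length v + length (alternate u v q)) ≡⟨ cong (λ t → length u + t) (length-++ v) ⟨
  length u + length (v ++ alternate u v q)       ≡⟨ length-++ u ⟨
  length (alternate u v (suc q))                 ∎
  where open ≤-Reasoning

inverse-mod : ∀ m′ {l} → Coprime (suc m′) l → ∃ λ u → (u * l) % suc m′ ≡ 1 % suc m′
inverse-mod m′ {l} cop with coprime-Bézout cop
... | Bézout.-+ x y 1+xm≡yl = y , (begin
  y * l % suc m′        ≡⟨ cong (_% suc m′) 1+xm≡yl ⟨
  (1 + x * suc m′) % suc m′ ≡⟨ [m+kn]%n≡m%n 1 x (suc m′) ⟩
  1 % suc m′            ∎)
  where open ≡-Reasoning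
... | Bézout.+- x y 1+yl≡xm = m′ * y , (begin
  m′ * y * l % suc m′                          ≡⟨ [m+kn]%n≡m%n (m′ * y * l) x (suc m′) ⟨
  (m′ * y * l + x * suc m′) % suc m′           ≡⟨ cong (λ t → (m′ * y * l + t) % suc m′) 1+yl≡xm ⟨
  (m′ * y * l + (1 + y * l)) % suc m′          ≡⟨ cong (_% suc m′) (rearrange m′ y l) ⟩
  (1 + (y * l) * suc m′) % suc m′              ≡⟨ [m+kn]%n≡m%n 1 (y * l) (suc m′) ⟩
  1 % suc m′                                   ∎)
  where
  open ≡-Reasoning
  rearrange : ∀ m′ y l → m′ * y * l + (1 + y * l) ≡ 1 + (y * l) * suc m′
  rearrange = solve-∀

[m%d*n]%d≡[m*n]%d : ∀ m n d .{{_ : NonZero d}} → (m % d * n) % d ≡ (m * n) % d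
[m%d*n]%d≡[m*n]%d m n d = begin
  (m % d * n) % d           ≡⟨ %-distribˡ-* (m % d) n d ⟩
  (m % d % d * (n % d)) % d ≡⟨ cong (λ t → (t * (n % d)) % d) (m%n%n≡m%n m d) ⟩
  (m % d * (n % d)) % d     ≡⟨ %-distribˡ-* m n d ⟨
  (m * n) % d               ∎
  where open ≡-Reasoning

[m*n%d]%d≡[m*n]%d : ∀ m n d .{{_ : NonZero d}} → (m * (n % d)) % d ≡ (m * n) % d
[m*n%d]%d≡[m*n]%d m n d = begin
  (m * (n % d)) % d ≡⟨ cong (_% d) (*-comm m (n % d)) ⟩
  (n % d * m) % d   ≡⟨ [m%d*n]%d≡[m*n]%d n m d ⟩
  (n * m) % d       ≡⟨ cong (_% d) (*-comm n m) ⟩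
  (m * n) % d       ∎
  where open ≡-Reasoning

module _ {m l u : ℕ} .{{_ : NonZero m}} (ul≡1 : (u * l) % m ≡ 1 % m) where

  solve-mod : ∀ r → (r * u % m * l) % m ≡ r % m
  solve-mod r = begin
    (r * u % m * l) % m   ≡⟨ [m%d*n]%d≡[m*n]%d (r * u) l m ⟩
    (r * u * l) % m       ≡⟨ cong (_% m) (*-assoc r u l) ⟩
    (r * (u * l)) % m     ≡⟨ [m*n%d]%d≡[m*n]%d r (u * l) m ⟨
    (r * (u * l % m)) % m ≡⟨ cong (λ t → (r * t) % m) ul≡1 ⟩
    (r * (1 % m)) % m     ≡⟨ [m*n%d]%d≡[m*n]%d r 1 m ⟩
    (r * 1) % m           ≡⟨ cong (_% m) (*-identityʳ r) ⟩
    r % m                 ∎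
    where open ≡-Reasoning

  -- b := (N mod m) u mod m has b l ≡ N (mod m) and b < m, so b l < N + m; being congruent
  -- to N modulo m, b l is then at most N.
  representable-by-inverse : ∀ N → m * l < N + (m + l) → ∃₂ λ a b → N ≡ a * m + b * l
  representable-by-inverse N bound = Q ∸ q , b , sym N≡
    where
    r = N % m
    b = r * u % m
    Q = N / m
    q = b * l / m
    N≡r+Qm : N ≡ r + Q * m
    N≡r+Qm = m≡m%n+[m/n]*n N m
    bl≡r+qm : b * l ≡ r + q * m
    bl≡r+qm = trans (m≡m%n+[m/n]*n (b * l) m) (cong (_+ q * m) (trans (solve-mod r) (m%n%n≡m%n N m)))
    bl<N+m : b * l < N + m
    bl<N+m = +-cancelˡ-< l (b * l) (N + m) (begin-strict
      l + b * l ≤⟨ *-monoˡ-≤ l (m%n<n (r * u) m) ⟩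
      m * l     <⟨ bound ⟩
      N + (m + l) ≡⟨ +-assoc N m l ⟨
      N + m + l ≡⟨ +-comm (N + m) l ⟩
      l + (N + m) ∎)
      where open ≤-Reasoning
    q≤Q : q ≤ Q
    q≤Q = ≤-pred (*-cancelʳ-< m q (suc Q) (+-cancelˡ-< r (q * m) (m + Q * m) (begin-strict
      r + q * m     ≡⟨ bl≡r+qm ⟨
      b * l         <⟨ bl<N+m ⟩
      N + m         ≡⟨ cong (_+ m) N≡r+Qm ⟩
      r + Q * m + m ≡⟨ +-assoc r (Q * m) m ⟩
      r + (Q * m + m) ≡⟨ cong (λ t → r + t) (+-comm (Q * m) m) ⟩
      r + (m + Q * m) ∎)))
      where open ≤-Reasoning
    N≡ : (Q ∸ q) * m + b * l ≡ N
    N≡ = begin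
      (Q ∸ q) * m + b * l       ≡⟨ cong (λ t → (Q ∸ q) * m + t) bl≡r+qm ⟩
      (Q ∸ q) * m + (r + q * m) ≡⟨ regroup (Q ∸ q) r q m ⟩
      r + (Q ∸ q + q) * m       ≡⟨ cong (λ t → r + t * m) (m∸n+n≡m q≤Q) ⟩
      r + Q * m                 ≡⟨ N≡r+Qm ⟨
      N                         ∎
      where
      open ≡-Reasoning
      regroup : ∀ a r q m → a * m + (r + q * m) ≡ r + (a + q) * m
      regroup = solve-∀

representable : ∀ m {l N} .{{_ : NonZero m}} → Coprime m l → m * l < N + (m + l) →
                ∃₂ λ a b → N ≡ a * m + b * l
representable (suc m′) {N = N} cop bound =
  let u , ul≡1 = inverse-mod m′ cop in representable-by-inverse {u = u} ul≡1 N bound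

g≡ : ∀ m l → m + l ≤ m * l → g m l ≡ + (m * l ∸ m ∸ l)
g≡ m l m+l≤ml = begin
  (+ (m * l) ℤ.- + m) ℤ.- + l ≡⟨ cong (ℤ._- + l) (trans (m-n≡m⊖n (m * l) m) (⊖-≥ m≤ml)) ⟩
  + (m * l ∸ m) ℤ.- + l       ≡⟨ trans (m-n≡m⊖n (m * l ∸ m) l) (⊖-≥ l≤ml∸m) ⟩
  + (m * l ∸ m ∸ l)           ∎
  where
  open ≡-Reasoning
  m≤ml : m ≤ m * l
  m≤ml = ≤-trans (m≤m+n m l) m+l≤ml
  l≤ml∸m : l ≤ m * l ∸ m
  l≤ml∸m = m+n≤o⇒m≤o∸n l (subst (_≤ m * l) (+-comm m l) m+l≤ml)

≤g : ∀ m l N → N + (m + l) ≤ m * l → + N ℤ.≤ g m l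
≤g m l N N+m+l≤ml rewrite g≡ m l (≤-trans (m≤n+m (m + l) N) N+m+l≤ml) =
  +≤+ (subst (N ≤_) (sym (∸-+-assoc (m * l) m l)) (m+n≤o⇒m≤o∸n N N+m+l≤ml))

module TwoLengths {k : ℕ} (x : Fin k) {m n : ℕ} (0<m : 0 < m) (m<n : m < n) (n<2m : n < 2 * m)
                  (S : Language (Fin k) 0ℓ) (S-length : ∀ w → S w → length w ≡ m ⊎ length w ≡ n)
                  (cof : CoFinite (Star S)) where

  -- S is not decidable, so membership facts are proved double-negated; they are only ever used
  -- against a word assumed to lie outside S*.
  open RawMonad (¬¬-Monad {a = 0ℓ})

  instance
    m-nonZero : NonZero m
    m-nonZero = >-nonZero 0<m

  Word : Set
  Word = List (Fin k)

  d c : ℕ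
  d = n ∸ m
  c = m ∸ d

  m+d≡n : m + d ≡ n
  m+d≡n = m+[n∸m]≡n (<⇒≤ m<n)

  0<d : 0 < d
  0<d = m<n⇒0<n∸m m<n

  d<m : d < m
  d<m = m<n+o⇒m∸n<o n m (subst (n <_) (cong (λ t → m + t) (+-identityʳ m)) n<2m)

  d+c≡m : d + c ≡ m
  d+c≡m = m+[n∸m]≡n (<⇒≤ d<m)

  m+Lm≡c+[d+Lm] : ∀ L → m + L * m ≡ c + (d + L * m)
  m+Lm≡c+[d+Lm] L = trans (cong (_+ L * m) (trans (sym d+c≡m) (+-comm d c))) (+-assoc c d (L * m))

  m≤|S| : ∀ {u} → S u → m ≤ length u
  m≤|S| {u} su with S-length u su
  ... | inj₁ |u|≡m = ≤-reflexive (sym |u|≡m)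
  ... | inj₂ |u|≡n = ≤-trans (<⇒≤ m<n) (≤-reflexive (sym |u|≡n))

  N : ℕ
  N = proj₁ (long-words cof)

  Star-long : ∀ w → N < length w → ¬ ¬ Star S w
  Star-long = proj₂ (long-words cof)

  Star-alternate⇒S : ∀ {u v w} q → length u ≡ m → length v ≡ d → Star S w → w ≡ alternate u v q → S u
  Star-alternate⇒S q |u| _ ε []≡ = ⊥-elim (
    <⇒≢ (≤-<-trans z≤n (length-alternate q (subst (0 <_) (sym |u|) 0<m))) (cong length []≡))
  Star-alternate⇒S {u} {v} q |u| |v| (_·_ {u′} {w′} su′ sw′) eq with S-length u′ su′ | q
  ... | inj₁ |u′|≡m | zero  =
    subst S (proj₁ (++-injective u′ u (trans |u′|≡m (sym |u|)) (trans eq (sym (++-identityʳ u))))) su′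
  ... | inj₁ |u′|≡m | suc _ = subst S (proj₁ (++-injective u′ u (trans |u′|≡m (sym |u|)) eq)) su′
  ... | inj₂ |u′|≡n | zero  = ⊥-elim (<⇒≱ m<n (begin
    n              ≡⟨ |u′|≡n ⟨
    length u′      ≤⟨ length-++-≤ˡ u′ ⟩
    length (u′ ++ w′) ≡⟨ cong length eq ⟩
    length u       ≡⟨ |u| ⟩
    m              ∎))
    where open ≤-Reasoning
  ... | inj₂ |u′|≡n | suc q′ =
    Star-alternate⇒S q′ |u| |v| sw′ (proj₂ (++-injective u′ (u ++ v) |u′|≡|uv| (trans eq (sym (++-assoc u v _)))))
    where
    |u′|≡|uv| : length u′ ≡ length (u ++ v)
    |u′|≡|uv| = trans |u′|≡n (sym (trans (length-++ u) (trans (cong₂ _+_ |u| |v|) m+d≡n)))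

  S-complete : ∀ {u} → length u ≡ m → ¬ ¬ S u
  S-complete {u} |u| u∉S = Star-long (alternate u v N) (length-alternate N (subst (0 <_) (sym |u|) 0<m))
    λ st → u∉S (Star-alternate⇒S N |u| (length-replicate d) st refl)
    where v = replicate d x

  Star-multiple-m : ∀ j {w} → length w ≡ j * m → ¬ ¬ Star S w
  Star-multiple-m = Star-multiple (λ |u| → S⊆Star <$> S-complete |u|)

  |y++e| : ∀ (y : Word) {e : Word} → length y ≡ d → length e ≡ c → length (y ++ e) ≡ m
  |y++e| y {e} |y| |e| = trans (length-++ y {e}) (trans (cong₂ _+_ |y| |e|) d+c≡m)

  |y++e++y′| : ∀ (y e y′ : Word) → length y ≡ d → length e ≡ c → length y′ ≡ d →
               length (y ++ e ++ y′) ≡ n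
  |y++e++y′| y e y′ |y| |e| |y′| = begin
    length (y ++ e ++ y′)   ≡⟨ cong length (++-assoc y e y′) ⟨
    length ((y ++ e) ++ y′) ≡⟨ length-++ (y ++ e) {y′} ⟩
    length (y ++ e) + length y′ ≡⟨ cong₂ _+_ (|y++e| y |y| |e|) |y′| ⟩
    m + d                   ≡⟨ m+d≡n ⟩
    n                       ∎
    where open ≡-Reasoning

  data Path : ℕ → Word → Word → Set where
    []   : ∀ {y} → Path 0 y y
    step : ∀ {L y z} e y′ → length e ≡ c → length y′ ≡ d → ¬ S (y ++ e ++ y′) →
           Path L y′ z → Path (suc L) y z

  trail : ∀ {L y z} → Path L y z → Word
  trail []                  = []
  trail (step e y′ _ _ _ p) = e ++ y′ ++ trail p

  trail-∉Star : ∀ {L y z w} → length y ≡ d → (p : Path L y z) → Star S w → w ≡ y ++ trail p → ⊥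
  trail-∉Star {y = y} |y| p ε []≡ = <⇒≱ 0<d (begin
    d                     ≡⟨ |y| ⟨
    length y              ≤⟨ length-++-≤ˡ y ⟩
    length (y ++ trail p) ≡⟨ cong length []≡ ⟨
    0                     ∎)
    where open ≤-Reasoning
  trail-∉Star {y = y} |y| [] (_·_ {u} {w} su sw) eq = <⇒≱ d<m (begin
    m                  ≤⟨ m≤|S| su ⟩
    length u           ≤⟨ length-++-≤ˡ u ⟩
    length (u ++ w)    ≡⟨ cong length (trans eq (++-identityʳ y)) ⟩
    length y           ≡⟨ |y| ⟩
    d                  ∎)
    where open ≤-Reasoning
  trail-∉Star {y = y} |y| (step e y′ |e| |y′| y++e++y′∉S p) (_·_ {u} su sw) eq with S-length u su
  ... | inj₁ |u|≡m = trail-∉Star |y′| p sw (proj₂ (++-injective u (y ++ e)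
        (trans |u|≡m (sym (|y++e| y |y| |e|)))
        (trans eq (sym (++-assoc y e (y′ ++ trail p))))))
  ... | inj₂ |u|≡n = y++e++y′∉S (subst S (proj₁ (++-injective u (y ++ e ++ y′)
        (trans |u|≡n (sym (|y++e++y′| y e y′ |y| |e| |y′|)))
        (trans eq (sym ([x++y++z]++w≡x++y++z++w y e y′))))) su)

  _++ᴾ_ : ∀ {L L′ x y z} → Path L x y → Path L′ y z → Path (L + L′) x z
  []                   ++ᴾ q = q
  step e y′ |e| |y′| b p ++ᴾ q = step e y′ |e| |y′| b (p ++ᴾ q)

  iterate : ∀ {L v} q → Path L v v → Path (q * L) v v
  iterate zero    _ = []
  iterate (suc q) p = p ++ᴾ iterate q p

  L≤|trail| : ∀ {L y z} (p : Path L y z) → L ≤ length (trail p)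
  L≤|trail| []                     = z≤n
  L≤|trail| (step e y′ _ |y′| _ p) = begin
    suc _                      ≤⟨ +-mono-≤ (subst (0 <_) (sym |y′|) 0<d) (L≤|trail| p) ⟩
    length y′ + length (trail p) ≡⟨ length-++ y′ ⟨
    length (y′ ++ trail p)     ≤⟨ length-++-≤ʳ (y′ ++ trail p) {e} ⟩
    length (e ++ y′ ++ trail p) ∎
    where open ≤-Reasoning

  no-cycle : ∀ {t v} → length v ≡ d → Path (suc t) v v → ⊥
  no-cycle {t} {v} |v| cycle = Star-long (v ++ trail cycleᴺ) N<|w| λ st → trail-∉Star |v| cycleᴺ st refl
    where
    cycleᴺ = iterate (suc N) cycle
    N<|w| : N < length (v ++ trail cycleᴺ)
    N<|w| = begin-strict
      N                         <⟨ n<1+n N ⟩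
      suc N                     ≤⟨ m≤m*n (suc N) (suc t) ⟩
      suc N * suc t             ≤⟨ L≤|trail| cycleᴺ ⟩
      length (trail cycleᴺ)     ≤⟨ length-++-≤ʳ (trail cycleᴺ) {v} ⟩
      length (v ++ trail cycleᴺ) ∎
      where open ≤-Reasoning

  vertex : ∀ {L y z} → Path L y z → Fin (suc L) → Word
  vertex {y = y} _                   zero    = y
  vertex         (step _ _ _ _ _ p) (suc i) = vertex p i

  length-vertex : ∀ {L y z} → length y ≡ d → (p : Path L y z) → ∀ i → length (vertex p i) ≡ d
  length-vertex |y| _                     zero    = |y|
  length-vertex _   (step _ _ _ |y′| _ p) (suc i) = length-vertex |y′| p i

  prefix : ∀ {L y z} (p : Path L y z) (i : Fin (suc L)) → Path (toℕ i) y (vertex p i)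
  prefix _                          zero    = []
  prefix (step e y′ |e| |y′| b p) (suc i) = step e y′ |e| |y′| b (prefix p i)

  Cycle : Set
  Cycle = ∃₂ λ v t → length v ≡ d × Path (suc t) v v

  repeat⇒cycle : ∀ {L y z} → length y ≡ d → (p : Path L y z) →
                 ∀ {i j} → toℕ i < toℕ j → vertex p i ≡ vertex p j → Cycle
  repeat⇒cycle {y = y} |y| p@(step _ _ _ _ _ _) {zero} {suc j} _ y≡ =
    y , toℕ j , |y| , subst (Path _ y) (sym y≡) (prefix p (suc j))
  repeat⇒cycle _ (step _ _ _ |y′| _ p) {suc i} {suc j} (s≤s i<j) eq = repeat⇒cycle |y′| p i<j eq

  long-path⇒cycle : ∀ {y z} → length y ≡ d → Path (k ^ d) y z → Cycle
  long-path⇒cycle |y| p =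
    let i , j , i<j , eq = words-pigeonhole (vertex p) (length-vertex |y| p) in repeat⇒cycle |y| p i<j eq

  blocked-path : ∀ L {pre y r} → ¬ ¬ Star S pre → length y ≡ d → length r ≡ L * m →
                 ¬ Star S (pre ++ y ++ r) → ∃ (Path L y)
  blocked-path zero    _ _ _ _ = _ , []
  blocked-path (suc L) {pre} {y} {r} pre∈S* |y| |r| pre++y++r∉S*
    with e , r₁ , refl , |e| , |r₁| ← split-length c r (trans |r| (m+Lm≡c+[d+Lm] L))
    with y′ , r₂ , refl , |y′| , |r₂| ← split-length d r₁ |r₁| =
    let z , p = blocked-path L pre′∈S* |y′| |r₂| pre′++y′++r₂∉S* in z , step e y′ |e| |y′| y++e++y′∉S p
    where
    pre′∈S* : ¬ ¬ Star S (pre ++ y ++ e)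
    pre′∈S* = do
      s₁ ← pre∈S*
      s₂ ← S-complete (|y++e| y |y| |e|)
      pure (Star-++ s₁ (S⊆Star s₂))
    pre′++y′++r₂∉S* : ¬ Star S ((pre ++ y ++ e) ++ y′ ++ r₂)
    pre′++y′++r₂∉S* = pre++y++r∉S* ∘ subst (Star S) ([x++y++z]++w≡x++y++z++w pre y e)
    y++e++y′∉S : ¬ S (y ++ e ++ y′)
    y++e++y′∉S s = (do
      s₁ ← pre∈S*
      s₃ ← Star-multiple-m L |r₂|
      pure (Star-++ s₁ (subst (Star S) ([x++y++z]++w≡x++y++z++w y e y′) (Star-++ (S⊆Star s) s₃))))
      pre++y++r∉S*

  l : ℕ
  l = ell k m n

  l≡d+Km : l ≡ d + k ^ d * m
  l≡d+Km = trans (+-comm (m * k ^ d) d) (cong (λ t → d + t) (*-comm m (k ^ d)))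

  Star-length-l : ∀ {w} → length w ≡ l → ¬ ¬ Star S w
  Star-length-l {w} |w| w∉S*
    with y , r , refl , |y| , |r| ← split-length d w (trans |w| l≡d+Km) =
    let _ , p = blocked-path (k ^ d) {[]} {y} {r} (pure ε) |y| |r| w∉S*
        _ , _ , |v| , cycle = long-path⇒cycle |y| p
    in no-cycle |v| cycle

  m-n-coprime : Coprime m n
  m-n-coprime {i} (i∣m , i∣n) = cofinite-divisor≡1 cof x (Star-length-∣ i∣|S|)
    where
    i∣|S| : ∀ {u} → S u → i ∣ length u
    i∣|S| {u} su with S-length u su
    ... | inj₁ |u|≡m = subst (i ∣_) (sym |u|≡m) i∣m
    ... | inj₂ |u|≡n = subst (i ∣_) (sym |u|≡n) i∣n

  m-l-coprime : Coprime m l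
  m-l-coprime {i} (i∣m , i∣l) = m-n-coprime (i∣m , subst (i ∣_) m+d≡n (∣m∣n⇒∣m+n i∣m i∣d))
    where
    i∣d : i ∣ d
    i∣d = ∣m+n∣m⇒∣n i∣l (∣m⇒∣m*n (k ^ d) i∣m)

  Star-am+bl : ∀ a b {w} → length w ≡ a * m + b * l → ¬ ¬ Star S w
  Star-am+bl a b {w} |w| with u , v , refl , |u| , |v| ← split-length (a * m) w |w| = do
    su ← Star-multiple-m a {u} |u|
    sv ← Star-multiple (λ {u} → Star-length-l {u}) b {v} |v|
    pure (Star-++ su sv)

  complement-bounded : ∀ w → ¬ Star S w → + length w ℤ.≤ g m l
  complement-bounded w w∉S* with length w + (m + l) ≤? m * l
  ... | yes short = ≤g m l (length w) short
  ... | no ¬short =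
    let a , b , |w| = representable m m-l-coprime (≰⇒> ¬short) in ⊥-elim (Star-am+bl a b |w| w∉S*)

  Star-length : ∀ {w} → Star S w → length w ≡ 0 ⊎ m ≤ length w
  Star-length ε               = inj₁ refl
  Star-length (_·_ {u} su sw) = inj₂ (≤-trans (m≤|S| su) (length-++-≤ˡ u))

  Star≢all : ¬ (∀ w → Star S w)
  Star≢all all with Star-length (all (x ∷ []))
  ... | inj₂ m≤1 = <⇒≱ (≤-<-trans 0<d d<m) m≤1

theorem20 : (k : ℕ) → 0 < k → (m n : ℕ) → 0 < m → m < n → n < 2 * m →
    (S : Language (Fin k) 0ℓ) →
    (∀ w → S w → length w ≡ m ⊎ length w ≡ n) →
    CoFinite (Star S) →
    (¬ (∀ (w : List (Fin k)) → Star S w))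
      × (∀ (w : List (Fin k)) → ¬ Star S w → + length w ℤ.≤ g m (ell k m n))
theorem20 k 0<k m n 0<m m<n n<2m S S-length cof = Star≢all , complement-bounded
  where open TwoLengths (fromℕ< 0<k) 0<m m<n n<2m S S-length cof
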